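{- Let $\boldsymbol{\alpha}$ be a set of $\mathcal{T}$-atoms and consider a form of $\mathcal{T}$-DDs which is $\mathcal{B}$-canonical with respect to some canonicity condition $K(\boldsymbol{\alpha})$. Suppose that for every $\mathcal{T}$-formula $\varphi[\boldsymbol{\alpha}]$, $$\mathcal{T}\text{ -DD}(\varphi[\boldsymbol{\alpha}])\ \equiv_{\mathcal{B}}\ \bigvee_{\eta_i\in\mathrm{TTA}^{\mathcal{T}}_{\boldsymbol{\alpha}}(\varphi)}\eta_i .$$ Then this form of $\mathcal{T}$-DDs is $\mathcal{T}$-canonical with respect to $K(\boldsymbol{\alpha})$.
   Context: All formulas are quantifier-free $\mathcal{T}$-formulas (Boolean combinations of ground $\mathcal{T}$-atoms, $\mathcal{T}$ a first-order theory). $\mathcal{T}2\mathcal{B}$ is the Boolean abstraction (bijection mapping Boolean atoms to themselves and other $\mathcal{T}$-atoms to fresh Boolean variables, homomorphic over connectives), $\mathcal{B}2\mathcal{T}$ its inverse, $\psi^p:=\mathcal{T}2\mathcal{B}(\psi)$. $\varphi[\boldsymbol{\alpha}]$ means $\varphi$ regarded over a set $\boldsymbol{\alpha}$ containing all its atoms. $\psi\equiv_{\mathcal{B}}\psi'$: $\psi^p,\psi'^p$ propositionally equivalent; $\psi\equiv_{\mathcal{T}}\psi'$: equivalent modulo $\mathcal{T}$. Truth assignments are conjunctions of literals; total on $\boldsymbol{\alpha}$ means one literal per atom of $\boldsymbol{\alpha}$; $\eta\models_p\varphi$ means $\eta^p\models\varphi^p$. $\mathrm{TTA}^{\mathcal{T}}_{\boldsymbol{\alpha}}(\varphi)$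 is the set of $\mathcal{T}$-consistent (satisfiable in some model of $\mathcal{T}$) total truth assignments $\eta$ on $\boldsymbol{\alpha}$ with $\eta\models_p\varphi$. A form of Boolean decision diagrams (e.g. OBDDs, SDDs) has a canonicity condition $K(\mathbf{A})$ on Boolean atoms $\mathbf{A}$ (e.g. variable order, v-tree). Given $\mathbf{A}=\mathcal{T}2\mathcal{B}(\boldsymbol{\alpha})$, a $\mathcal{T}$-DD of $\varphi[\boldsymbol{\alpha}]$ with canonicity condition $K(\boldsymbol{\alpha})$ is a $\mathcal{T}$-formula $\Psi[\boldsymbol{\alpha}]$ with $\Psi\equiv_{\mathcal{T}}\varphi$ whose Boolean abstraction $\Psi^p[\mathbf{A}]$ is a decision diagram of that form; equality of $\mathcal{T}$-DDs is identity of diagrams. A form of $\mathcal{T}$-DD is $\mathcal{B}$-canonical w.r.t. $K(\boldsymbol{\alpha})$ if for all $\varphi[\boldsymbol{\alpha}],\varphi'[\boldsymbol{\alpha}]$: $\mathcal{T}\text{ -DD}(\varphi)=\mathcal{T}\text{ -DD}(\varphi')$ whenever $\varphi\equiv_{\mathcal{B}}\varphi'$. It is $\mathcal{T}$-canonical w.r.t. $K(\boldsymbol{\alpha})$ if for all $\varphi[\boldsymbol{\alpha}],\varphi'[\boldsymbol{\alpha}]$: $\mathcal{T}\text{ -DD}(\varphi)=\mathcal{T}\text{ -DD}(\varphi')$ if and only if $\varphi\equiv_{\mathcal{T}}\varphi'$. -}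

module Defs where

open import Data.Nat using (ℕ)
open import Data.Fin using (Fin)
open import Data.Bool using (Bool; true; false; not; _∧_; _∨_)
open import Data.Product using (Σ; _×_; _,_; ∃)
open import Relation.Binary.PropositionalEquality using (_≡_)
open import Function.Bundles using (_⇔_)
open import Level using (Level; suc; _⊔_)

-- A variable `atom i` stands for the i-th atom of α; thus `Formula n`
-- is literally the Boolean abstraction ψ^p of a T-formula ψ[α], and T2B/B2T
-- is the identity on this syntax (the bijection is given by α below).
data Formula (n : ℕ) : Set where
  atom : Fin n → Formula n
  ⊤f ⊥f : Formula n
  ¬f_ : Formula n → Formula n
  _∧f_ _∨f_ : Formula n → Formula n → Formula n

evalB : ∀ {n} → (Fin n → Bool) → Formula n → Bool
evalB μ (atom i) = μ i
evalB μ ⊤f = true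
evalB μ ⊥f = false
evalB μ (¬f φ) = not (evalB μ φ)
evalB μ (φ ∧f ψ) = evalB μ φ ∧ evalB μ ψ
evalB μ (φ ∨f ψ) = evalB μ φ ∨ evalB μ ψ

record Theory (a m : Level) : Set (suc (a ⊔ m)) where
  field
    Atom  : Set a
    Model : Set m
    holds : Model → Atom → Bool

module _ {a m} (T : Theory a m) {n : ℕ} (α : Fin n → Theory.Atom T) where
  open Theory T

  modelAssign : Model → Fin n → Bool
  modelAssign M i = holds M (α i)

  _≡B_ : Formula n → Formula n → Set
  ψ ≡B ψ' = ∀ (μ : Fin n → Bool) → evalB μ ψ ≡ evalB μ ψ'

  _≡T_ : Formula n → Formula n → Set (m)
  ψ ≡T ψ' = ∀ (M : Model) → evalB (modelAssign M) ψ ≡ evalB (modelAssign M) ψ'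

  TConsistent : (Fin n → Bool) → Set m
  TConsistent η = Σ Model λ M → ∀ i → modelAssign M i ≡ η i

  TTA : Formula n → (Fin n → Bool) → Set m
  TTA φ η = TConsistent η × (evalB η φ ≡ true)

  -- μ ⊨ η where η is a total truth assignment viewed as the conjunction
  -- of its literals
  satAssign : (Fin n → Bool) → (Fin n → Bool) → Set
  satAssign μ η = ∀ i → μ i ≡ η i

  -- ψ ≡_B ⋁_{η ∈ TTA^T_α(φ)} η : for every Boolean assignment μ,
  -- μ ⊨ ψ^p iff μ satisfies one of the disjuncts η.
  _≡B-TTA_ : Formula n → Formula n → Set m
  ψ ≡B-TTA φ = ∀ (μ : Fin n → Bool) →
    (evalB μ ψ ≡ true) ⇔ ∃ (λ η → TTA φ η × satAssign μ η)

  -- A form of T-DDs for the fixed canonicity condition K(α):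
  -- a type of diagrams (compared by identity), the T-formula Ψ each diagram
  -- represents (its Boolean abstraction is the diagram), and the map
  -- φ ↦ T-DD(φ), with T-DD(φ) ≡_T φ.  `idem`: a formula which already is
  -- (the T-formula of) a T-DD of this form is its own T-DD, i.e. the
  -- construction leaves diagrams of the form unchanged.
  record TDDForm (d : Level) : Set (suc d ⊔ m) where
    field
      Diagram   : Set d
      toFormula : Diagram → Formula n
      TDD       : Formula n → Diagram
      sound     : ∀ φ → toFormula (TDD φ) ≡T φ
      idem      : ∀ φ → TDD (toFormula (TDD φ)) ≡ TDD φ

  module _ {d} (F : TDDForm d) where
    open TDDForm F

    BCanonical : Set d
    BCanonical = ∀ φ φ' → φ ≡B φ' → TDD φ ≡ TDD φ'

    TCanonical : Set (d ⊔ m)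
    TCanonical = ∀ φ φ' → (TDD φ ≡ TDD φ') ⇔ (φ ≡T φ')

-- A T-DD is T-equivalent to its input, so equal diagrams give T-equivalent
-- formulas. Conversely, T-equivalent formulas have the same T-consistent
-- total assignments, so by hypothesis their diagrams have propositionally
-- equivalent abstractions; B-canonicity then identifies the diagrams of the
-- diagrams, and these are the original diagrams because the construction
-- leaves diagrams of the form unchanged.
module Submission where

open import Defs
open import Data.Nat using (ℕ)
open import Data.Fin using (Fin)
open import Data.Bool using (Bool; true; not; _∧_; _∨_)
open import Data.Bool.Properties using (⇔→≡)
open import Data.Product using (_,_; ∃; _×_; map₁)
open import Function.Bundles using (_⇔_; mk⇔)
import Function.Properties.Equivalence as ⇔
open import Function.Base using (_∘_)
open import Level using (Level)
open import Relation.Binary.PropositionalEquality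
  using (_≡_; refl; sym; trans; cong; cong₂; module ≡-Reasoning)

evalB-cong : ∀ {n} {μ ν : Fin n → Bool} → (∀ i → μ i ≡ ν i) →
             ∀ φ → evalB μ φ ≡ evalB ν φ
evalB-cong e (atom i) = e i
evalB-cong e ⊤f       = refl
evalB-cong e ⊥f       = refl
evalB-cong e (¬f φ)   = cong not (evalB-cong e φ)
evalB-cong e (φ ∧f ψ) = cong₂ _∧_ (evalB-cong e φ) (evalB-cong e ψ)
evalB-cong e (φ ∨f ψ) = cong₂ _∨_ (evalB-cong e φ) (evalB-cong e ψ)

module _ {a m} (T : Theory a m) {n : ℕ} (α : Fin n → Theory.Atom T) where

  TTA-resp-≡T : ∀ φ φ' → _≡T_ T α φ φ' → ∀ η → TTA T α φ η → TTA T α φ' η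
  TTA-resp-≡T φ φ' eq η ((M , M⊨η) , η⊨φ) = (M , M⊨η) , (begin
      evalB η φ'                   ≡⟨ evalB-cong M⊨η φ' ⟨
      evalB (modelAssign T α M) φ' ≡⟨ eq M ⟨
      evalB (modelAssign T α M) φ  ≡⟨ evalB-cong M⊨η φ ⟩
      evalB η φ                    ≡⟨ η⊨φ ⟩
      true                         ∎)
    where open ≡-Reasoning

  ≡B-TTA-resp-≡T : ∀ ψ ψ' φ φ' → _≡B-TTA_ T α ψ φ → _≡B-TTA_ T α ψ' φ' →
                   _≡T_ T α φ φ' → _≡B_ T α ψ ψ'
  ≡B-TTA-resp-≡T ψ ψ' φ φ' ψ~φ ψ'~φ' eq μ =
    ⇔→≡ (⇔.trans (ψ~φ μ) (⇔.trans same-TTA (⇔.sym (ψ'~φ' μ))))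
    where
    same-TTA : ∃ (λ η → TTA T α φ η × satAssign T α μ η) ⇔
               ∃ (λ η → TTA T α φ' η × satAssign T α μ η)
    same-TTA = mk⇔ (λ (η , t) → η , map₁ (TTA-resp-≡T φ φ' eq η) t)
                   (λ (η , t) → η , map₁ (TTA-resp-≡T φ' φ (sym ∘ eq) η) t)

  module _ {d} (F : TDDForm T α d) where
    open TDDForm F

    TDD-≡⇒≡T : ∀ φ φ' → TDD φ ≡ TDD φ' → _≡T_ T α φ φ'
    TDD-≡⇒≡T φ φ' e M = begin
      evalB (modelAssign T α M) φ                    ≡⟨ sound φ M ⟨
      evalB (modelAssign T α M) (toFormula (TDD φ))  ≡⟨ cong (evalB (modelAssign T α M) ∘ toFormula) e ⟩
      evalB (modelAssign T α M) (toFormula (TDD φ')) ≡⟨ sound φ' M ⟩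
      evalB (modelAssign T α M) φ'                   ∎
      where open ≡-Reasoning

    BCanonical⇒TDD-cong : BCanonical T α F → ∀ φ φ' →
      _≡B_ T α (toFormula (TDD φ)) (toFormula (TDD φ')) → TDD φ ≡ TDD φ'
    BCanonical⇒TDD-cong bc φ φ' eq =
      trans (sym (idem φ)) (trans (bc _ _ eq) (idem φ'))

theorem2 : ∀ {a m d : Level} (T : Theory a m) (n : ℕ) (α : Fin n → Theory.Atom T)
    (F : TDDForm T α d) →
    BCanonical T α F →
    (∀ (φ : Formula n) → _≡B-TTA_ T α (TDDForm.toFormula F (TDDForm.TDD F φ)) φ) →
    TCanonical T α F
theorem2 T n α F bc tta φ φ' = mk⇔
  (TDD-≡⇒≡T T α F φ φ')
  (λ φ≡Tφ' → BCanonical⇒TDD-cong T α F bc φ φ'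
    (≡B-TTA-resp-≡T T α (toFormula (TDD φ)) (toFormula (TDD φ')) φ φ' (tta φ) (tta φ') φ≡Tφ'))
  where open TDDForm F
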